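{- Let $D$ be a ruleset of a language $S$. If $\{R_\cup,R_c\}\subseteq D$ and $D$ is monotone, then $D$ is cut-like.
   Context: A language $S$ has formulas built from atomic formulas by the NOR connective $\downarrow\varphi\psi$ and existential quantification; $\neg\varphi:=\downarrow\varphi\varphi$. A sequent is $(\Gamma,\varphi)$ with $\Gamma$ a finite set of formulas and $\varphi$ a formula; a rule is a map from sets of sequents to sets of sequents; a ruleset is a set of rules. $O_D(\Sigma)=\bigcup_{R\in D}R(\Sigma)$, $O^n_D$ its iterates. $X\vdash_D\varphi$ iff $(\Gamma,\varphi)\in O^n_D(\emptyset)$ for some $n$ and finite $\Gamma\subseteq X$. $X$ is $D$-inconsistent if there is a formula $\psi$ with $X\vdash_D\psi$ and $X\vdash_D\neg\psi$. $D$ is cut-like if for all $X,\varphi$: $X\cup\{\varphi\}$ $D$-inconsistent implies $X\vdash_D\neg\varphi$. $D$ is monotone if $\Sigma_1\subseteq\Sigma_2$ implies $O_D(\Sigma_1)\subseteq O_D(\Sigma_2)$. Rules: $R_\cup(\Sigma)=\{(\Gamma,\varphi):\exists(\Gamma',\varphi)\in\Sigma,\ \Gamma'\subseteq\Gamma\}$; $R_c(\Sigma)=\{(\Gamma,\neg\varphi):\exists\psi,\ (\Gamma\cup\{\varphi\},\psi)\in\Sigma\text{ and }(\Gamma\cup\{\varphi\},\neg\psi)\in\Sigma\}$. -}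

module Defs where

open import Level using (Level) renaming (suc to lsuc; zero to lzero)
open import Data.Nat using (ℕ; zero; suc)
open import Data.Product using (Σ; ∃; _×_; _,_)
open import Data.Sum using (_⊎_)
open import Data.List using (List; _∷_; [])
open import Data.List.Membership.Propositional using (_∈_)
open import Relation.Binary.PropositionalEquality using (_≡_)

record Language : Set₁ where
  field
    Atom : Set
    Var  : Set

module Logic (S : Language) where
  open Language S

  data Formula : Set where
    atom : Atom → Formula
    nor  : Formula → Formula → Formula
    ex   : Var → Formula → Formula

  ¬' : Formula → Formula
  ¬' φ = nor φ φ

  -- finite sets of formulas, represented by lists (up to having the same elements)
  FinSet : Set
  FinSet = List Formula

  _⊆ᶠ_ : FinSet → FinSet → Set
  Γ ⊆ᶠ Δ = ∀ {x} → x ∈ Γ → x ∈ Δ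

  _≈ᶠ_ : FinSet → FinSet → Set
  Γ ≈ᶠ Δ = (Γ ⊆ᶠ Δ) × (Δ ⊆ᶠ Γ)

  FSet : Set₁
  FSet = Formula → Set

  _∪｛_｝ : FSet → Formula → FSet
  (X ∪｛ φ ｝) x = X x ⊎ x ≡ φ

  Sequent : Set
  Sequent = FinSet × Formula

  SeqSet : Set₁
  SeqSet = Sequent → Set

  _⊆ˢ_ : SeqSet → SeqSet → Set
  Σ₁ ⊆ˢ Σ₂ = ∀ s → Σ₁ s → Σ₂ s

  ∅ˢ : SeqSet
  ∅ˢ _ = Data.Empty.⊥
    where import Data.Empty

  Rule : Set₁
  Rule = SeqSet → SeqSet

  record Ruleset : Set₁ where
    field
      Idx  : Set
      rule : Idx → Rule
  open Ruleset public

  _≐_ : Rule → Rule → Set₁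
  R₁ ≐ R₂ = ∀ (Σ' : SeqSet) (s : Sequent) → (R₁ Σ' s → R₂ Σ' s) × (R₂ Σ' s → R₁ Σ' s)

  _∈ᴿ_ : Rule → Ruleset → Set₁
  R ∈ᴿ D = Σ (Idx D) (λ i → rule D i ≐ R)

  O : Ruleset → SeqSet → SeqSet
  O D Σ' s = Σ (Idx D) (λ i → rule D i Σ' s)

  O^ : Ruleset → ℕ → SeqSet → SeqSet
  O^ D zero    Σ' = Σ'
  O^ D (suc n) Σ' = O D (O^ D n Σ')

  _⊢[_]_ : FSet → Ruleset → Formula → Set
  X ⊢[ D ] φ = Σ ℕ (λ n → Σ FinSet (λ Γ → O^ D n ∅ˢ (Γ , φ) × (∀ {x} → x ∈ Γ → X x)))

  Inconsistent : Ruleset → FSet → Set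
  Inconsistent D X = Σ Formula (λ ψ → (X ⊢[ D ] ψ) × (X ⊢[ D ] ¬' ψ))

  CutLike : Ruleset → Set₁
  CutLike D = ∀ (X : FSet) (φ : Formula) → Inconsistent D (X ∪｛ φ ｝) → X ⊢[ D ] ¬' φ

  Monotone : Ruleset → Set₁
  Monotone D = ∀ (Σ₁ Σ₂ : SeqSet) → Σ₁ ⊆ˢ Σ₂ → O D Σ₁ ⊆ˢ O D Σ₂

  R∪ : Rule
  R∪ Σ' (Γ , φ) = Σ FinSet (λ Γ' → Σ' (Γ' , φ) × (Γ' ⊆ᶠ Γ))

  -- R_c(Σ) = {(Γ,¬φ) : ∃ψ, (Γ∪{φ},ψ) ∈ Σ and (Γ∪{φ},¬ψ) ∈ Σ}
  -- Γ ∪ {φ} is any list with the same elements as φ ∷ Γ.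
  Rc : Rule
  Rc Σ' (Γ , χ) = Σ Formula (λ φ → χ ≡ ¬' φ × Σ Formula (λ ψ →
    Σ FinSet (λ Δ → Δ ≈ᶠ (φ ∷ Γ) × Σ' (Δ , ψ)) ×
    Σ FinSet (λ Δ → Δ ≈ᶠ (φ ∷ Γ) × Σ' (Δ , ¬' ψ))))

-- Suppose X ∪ {φ} derives ψ and ¬ψ from finite contexts Γ₁ and Γ₂, and let Γᵢ' ⊆ X be Γᵢ
-- with φ removed. Monotonicity replays both derivations at a common stage n, one application
-- of R∪ moves them to the context {φ} ∪ Γ₁' ∪ Γ₂', and one application of Rc then yields
-- (Γ₁' ∪ Γ₂', ¬φ) at stage n + 2.
module Submission where

open import Defs
open import Function using (_∘_)
open import Data.Product using (Σ; _×_; _,_; proj₂)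
open import Data.Sum using ([_,_]; inj₁; inj₂)
open import Data.Nat using (suc; _≤_; _⊔_; z≤n; s≤s)
open import Data.Nat.Properties using (m≤m⊔n; m≤n⊔m)
open import Data.List using ([]; _∷_; _++_)
open import Data.List.Relation.Unary.Any using (here; there)
open import Data.List.Membership.Propositional.Properties using (∈-++⁻)
open import Data.List.Relation.Binary.Subset.Propositional.Properties
  using (⊆-refl; ⊆-trans; xs⊆x∷xs; ∷⁺ʳ; ∈-∷⁺ʳ; xs⊆xs++ys; xs⊆ys++xs)
open import Data.List.Membership.Propositional using (_∈_)
open import Relation.Binary.PropositionalEquality using (refl)

module CutLikeness (S : Language) where
  open Logic S

  _⊆ᶠˢ_ : FinSet → FSet → Set
  Γ ⊆ᶠˢ X = ∀ {x} → x ∈ Γ → X x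

  ++-⊆ᶠˢ : ∀ {X} Γ {Δ} → Γ ⊆ᶠˢ X → Δ ⊆ᶠˢ X → (Γ ++ Δ) ⊆ᶠˢ X
  ++-⊆ᶠˢ Γ Γ⊆X Δ⊆X = [ Γ⊆X , Δ⊆X ] ∘ ∈-++⁻ Γ

  ⊆ᶠˢ-∪｛｝ : ∀ {X φ} Γ → Γ ⊆ᶠˢ (X ∪｛ φ ｝) →
             Σ FinSet λ Γ' → Γ' ⊆ᶠˢ X × Γ ⊆ᶠ (φ ∷ Γ')
  ⊆ᶠˢ-∪｛｝ [] _ = [] , (λ ()) , (λ ())
  ⊆ᶠˢ-∪｛｝ {φ = φ} (γ ∷ Γ) γΓ⊆X∪φ
    with ⊆ᶠˢ-∪｛｝ Γ (γΓ⊆X∪φ ∘ there) | γΓ⊆X∪φ (here refl)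
  ... | Γ' , Γ'⊆X , Γ⊆φΓ' | inj₁ γ∈X =
    γ ∷ Γ' ,
    (λ { (here refl) → γ∈X ; (there x∈Γ') → Γ'⊆X x∈Γ' }) ,
    ∈-∷⁺ʳ (there (here refl)) (⊆-trans Γ⊆φΓ' (∷⁺ʳ φ (xs⊆x∷xs Γ' γ)))
  ... | Γ' , Γ'⊆X , Γ⊆φΓ' | inj₂ refl = Γ' , Γ'⊆X , ∈-∷⁺ʳ (here refl) Γ⊆φΓ'

  module _ {D : Ruleset} where

    ∈ᴿ⇒⊆O : ∀ {R} → R ∈ᴿ D → ∀ Σ' → R Σ' ⊆ˢ O D Σ'
    ∈ᴿ⇒⊆O (i , rule≐R) Σ' s r = i , proj₂ (rule≐R Σ' s) r

    O^-mono : Monotone D → ∀ {m n} → m ≤ n → O^ D m ∅ˢ ⊆ˢ O^ D n ∅ˢ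
    O^-mono mono z≤n       _ ()
    O^-mono mono (s≤s m≤n) = mono _ _ (O^-mono mono m≤n)

    R∪-weaken : R∪ ∈ᴿ D → ∀ {Σ' Γ Δ ψ} → Σ' (Γ , ψ) → Γ ⊆ᶠ Δ → O D Σ' (Δ , ψ)
    R∪-weaken R∪∈D {Σ'} {Γ} {Δ} d Γ⊆Δ = ∈ᴿ⇒⊆O R∪∈D Σ' (Δ , _) (Γ , d , Γ⊆Δ)

    Rc-reductio : Rc ∈ᴿ D → ∀ {Σ' Γ φ ψ} →
                  Σ' (φ ∷ Γ , ψ) → Σ' (φ ∷ Γ , ¬' ψ) → O D Σ' (Γ , ¬' φ)
    Rc-reductio Rc∈D {Σ'} {Γ} {φ} {ψ} d d¬ =
      ∈ᴿ⇒⊆O Rc∈D Σ' (Γ , ¬' φ)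
        (φ , refl , ψ , (φ ∷ Γ , (⊆-refl , ⊆-refl) , d) , (φ ∷ Γ , (⊆-refl , ⊆-refl) , d¬))

    monotone⇒cutLike : R∪ ∈ᴿ D → Rc ∈ᴿ D → Monotone D → CutLike D
    monotone⇒cutLike R∪∈D Rc∈D mono X φ (ψ , (n₁ , Γ₁ , d₁ , Γ₁⊆Xφ) , (n₂ , Γ₂ , d₂ , Γ₂⊆Xφ))
      with ⊆ᶠˢ-∪｛｝ Γ₁ Γ₁⊆Xφ | ⊆ᶠˢ-∪｛｝ Γ₂ Γ₂⊆Xφ
    ... | Γ₁' , Γ₁'⊆X , Γ₁⊆φΓ₁' | Γ₂' , Γ₂'⊆X , Γ₂⊆φΓ₂' =
      suc (suc (n₁ ⊔ n₂)) , Γ₁' ++ Γ₂' ,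
      Rc-reductio Rc∈D
        (R∪-weaken R∪∈D (O^-mono mono (m≤m⊔n n₁ n₂) _ d₁)
          (⊆-trans Γ₁⊆φΓ₁' (∷⁺ʳ φ (xs⊆xs++ys Γ₁' Γ₂'))))
        (R∪-weaken R∪∈D (O^-mono mono (m≤n⊔m n₁ n₂) _ d₂)
          (⊆-trans Γ₂⊆φΓ₂' (∷⁺ʳ φ (xs⊆ys++xs Γ₂' Γ₁')))) ,
      ++-⊆ᶠˢ Γ₁' Γ₁'⊆X Γ₂'⊆X

mainTheorem10 : (S : Language) → let open Logic S in
    (D : Ruleset) → R∪ ∈ᴿ D × Rc ∈ᴿ D → Monotone D → CutLike D
mainTheorem10 S D (R∪∈D , Rc∈D) = CutLikeness.monotone⇒cutLike S R∪∈D Rc∈D
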